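{- For every $c\geq 1$ let $L_c=(1,1,c)$. Then for every $n>2$, $$\lim_{c\to\infty}\rho_{n,L_c}=\frac{n-2}{n}.$$
   Context: Let $X$ be an alphabet with $n$ letters and $X^*$ the set of words over $X$. A code over $X$ is a finite sequence $C=(v_1,\ldots,v_m)$ of words over $X$ such that every $w\in X^*$ has at most one factorization into code-words: if $w=v_{i_1}\cdots v_{i_l}=v_{j_1}\cdots v_{j_{l'}}$ with $l,l'\geq 1$, then $l=l'$ and $i_t=j_t$ for all $t$. A code $(v_1,\ldots,v_m)$ is a prefix code if for all $i,j$, $v_i$ is a prefix of $v_j$ iff $i=j$. For a finite sequence $L=(a_1,\ldots,a_m)$ of natural numbers, $UD_n(L)$ is the set of codes $(v_1,\ldots,v_m)$ over $X$ with $|v_i|=a_i$ for all $i$, $PR_n(L)\subseteq UD_n(L)$ is the subset of prefix codes, and $\rho_{n,L}=|PR_n(L)|/|UD_n(L)|$. -}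

module Defs where

open import Data.Nat using (ℕ; zero; suc)
open import Data.Fin using (Fin)
open import Data.List using (List; []; concat; map; length)
open import Data.List.Relation.Unary.All using (All)
open import Data.List.Relation.Unary.Unique.Propositional using (Unique)
open import Data.List.Membership.Propositional using (_∈_)
open import Data.Vec using (Vec; lookup)
open import Data.Product using (Σ; ∃; _×_)
open import Data.Integer using (+_)
open import Data.Rational using (ℚ; _/_; 0ℚ)
open import Relation.Binary.PropositionalEquality using (_≡_; _≢_)
open import Function.Bundles using (_⇔_)

Word : ℕ → Set
Word n = List (Fin n)

cat : ∀ {n m} → Vec (Word n) m → List (Fin m) → Word n
cat v is = concat (map (lookup v) is)

IsCode : ∀ {n m} → Vec (Word n) m → Set
IsCode {n} {m} v = (is js : List (Fin m)) → is ≢ [] → js ≢ [] →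
                   cat v is ≡ cat v js → is ≡ js

IsPrefix : ∀ {n} → Word n → Word n → Set
IsPrefix {n} u w = Σ (Word n) λ s → Data.List._++_ u s ≡ w

HasLengths : ∀ {n m} → Vec ℕ m → Vec (Word n) m → Set
HasLengths {n} {m} L v = (i : Fin m) → length (lookup v i) ≡ lookup L i

InUD : (n : ℕ) → ∀ {m} → Vec ℕ m → Vec (Word n) m → Set
InUD n L v = HasLengths L v × IsCode v

InPR : (n : ℕ) → ∀ {m} → Vec ℕ m → Vec (Word n) m → Set
InPR n {m} L v = InUD n L v × ((i j : Fin m) → IsPrefix (lookup v i) (lookup v j) ⇔ (i ≡ j))

-- xs is an exact duplicate-free enumeration of the set {x | P x};
-- hence |{x | P x}| = length xs.
Enumerates : {A : Set} → (A → Set) → List A → Set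
Enumerates {A} P xs = Unique xs × All P xs × ((x : A) → P x → x ∈ xs)

-- the rational p / q (with the convention p / 0 = 0, never used since UD_n(L) ≠ ∅)
frac : ℕ → ℕ → ℚ
frac p zero = 0ℚ
frac p (suc q) = (+ p) / suc q

Lc : ℕ → Vec ℕ 3
Lc c = Data.Vec._∷_ 1 (Data.Vec._∷_ 1 (Data.Vec._∷_ c Data.Vec.[]))

-- A code with lengths (1, 1, c) is a triple ([a], [b], w). It is uniquely decipherable
-- iff a ≠ b and w is not a word over {a, b}: the first letter of w outside {a, b} then
-- fixes where every occurrence of w in a concatenation starts. It is a prefix code iff
-- moreover the very first letter of w lies outside {a, b}. Counting over the
-- D = n (n - 1) ordered pairs (a, b) gives |UD| = D (n^c - 2^c) and
-- |PR| = D (n - 2) n^(c-1), so ρ - (n - 2)/n = (n - 2) 2^c / (n (n^c - 2^c)). This is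
-- below 1/(d+1), hence below ε = (e+1)/(d+1), once c ≥ 2(d+1), because (3/2)^c ≥ 1 + c/2.
module Submission where

open import Defs
open import Data.Nat using (ℕ; zero; suc; _+_; _*_; _^_; _∸_; _≤_; _<_; s≤s; z≤n; z<s; >-nonZero)
open import Data.Nat.Properties hiding (_≟_)
open import Data.Nat.Tactic.RingSolver using (solve-∀)
open import Data.Nat.Coprimality using (Coprime)
import Data.Integer as ℤ
import Data.Integer.Properties as ℤ
import Data.Integer.Tactic.RingSolver as ℤ-Solver
open import Data.Rational using (ℚ; 0ℚ; mkℚ; ∣_∣; _-_; toℚᵘ; *<*) renaming (_<_ to _<ℚ_)
import Data.Rational as ℚ using (-_)
import Data.Rational.Properties as ℚ
import Data.Rational.Unnormalised as ℚᵘ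
import Data.Rational.Unnormalised.Properties as ℚᵘ
open import Data.Fin using (Fin; zero; suc; _≟_)
open import Data.List
  using (List; []; _∷_; _++_; length; map; concatMap; filter; allFin;
         cartesianProductWith; cartesianProduct)
open import Data.List.Properties
  using (length-map; length-++; length-tabulate; ∷-injectiveˡ; ∷-injectiveʳ; ++-assoc; ++-cancelˡ;
         ++-identityʳ; ++-conicalˡ; ++-conicalʳ)
open import Data.List.Relation.Unary.All as All using (All; []; _∷_)
open import Data.List.Relation.Unary.All.Properties as All using ()
open import Data.List.Relation.Unary.AllPairs as AllPairs using ([]; _∷_)
open import Data.List.Relation.Unary.AllPairs.Properties as AllPairs using ()
open import Data.List.Relation.Unary.Any using (here; there)
open import Data.List.Relation.Unary.First as First using (First; first)
open import Data.List.Relation.Unary.First.Properties using (first?; toView; All⇒¬First)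
open import Data.List.Relation.Unary.Unique.Propositional using (Unique)
open import Data.List.Relation.Unary.Unique.Propositional.Properties as Unique using ()
open import Data.List.Membership.Propositional using (_∈_; _∉_; find; lose)
open import Data.List.Membership.Propositional.Properties
open import Data.List.Membership.Propositional.Properties.WithK using (unique∧set⇒bag)
open import Data.List.Relation.Binary.BagAndSetEquality using (∼bag⇒↭)
open import Data.List.Relation.Binary.Permutation.Propositional.Properties using (↭-length)
open import Data.Vec using (Vec; lookup; _∷_; [])
open import Data.Product using (∃-syntax; ∃₂; _×_; _,_; proj₁; proj₂)
open import Data.Sum using (_⊎_; inj₁; inj₂)
open import Data.Empty using (⊥)
open import Function using (_∘_; _⇔_; mk⇔; Equivalence; case_of_)
open import Relation.Binary.PropositionalEquality
open import Relation.Nullary using (¬_; yes; no; ¬?; contradiction)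
open import Relation.Nullary.Decidable using (toSum; decidable-stable)
open import Relation.Unary using (Decidable)
open import Relation.Unary.Properties using (∁?)

open Equivalence using (to; from)

module _ {A : Set} where

  unique-⇔-length : {xs ys : List A} → Unique xs → Unique ys →
                    (∀ {x} → x ∈ xs ⇔ x ∈ ys) → length xs ≡ length ys
  unique-⇔-length xs! ys! xs⇔ys = ↭-length (∼bag⇒↭ (unique∧set⇒bag xs! ys! xs⇔ys))

  enumerates : {P : A → Set} {xs : List A} → Unique xs → (∀ {x} → x ∈ xs ⇔ P x) →
               Enumerates P xs
  enumerates xs! xs⇔P = xs! , All.tabulate (to xs⇔P) , λ _ → from xs⇔P

  enumerates-length : {P : A → Set} {xs ys : List A} →
                      Enumerates P xs → Enumerates P ys → length xs ≡ length ys
  enumerates-length (xs! , Pxs , xs∋) (ys! , Pys , ys∋) = unique-⇔-length xs! ys!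
    (mk⇔ (λ x∈xs → ys∋ _ (All.lookup Pxs x∈xs)) (λ x∈ys → xs∋ _ (All.lookup Pys x∈ys)))

  length-filter+length-filter-∁ : {P : A → Set} (P? : Decidable P) (xs : List A) →
    length (filter P? xs) + length (filter (∁? P?) xs) ≡ length xs
  length-filter+length-filter-∁ P? [] = refl
  length-filter+length-filter-∁ P? (x ∷ xs) with P? x
  ... | yes _ = cong suc (length-filter+length-filter-∁ P? xs)
  ... | no  _ = trans (+-suc _ _) (cong suc (length-filter+length-filter-∁ P? xs))

  length-filter-by-complement : {P : A → Set} (P? : Decidable P) {xs ys : List A} →
    Unique xs → Unique ys → (∀ {x} → x ∈ ys ⇔ (x ∈ xs × ¬ P x)) →
    length (filter P? xs) ≡ length xs ∸ length ys
  length-filter-by-complement P? {xs} {ys} xs! ys! ys⇔ =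
    trans (sym (m+n∸n≡m _ (length ys))) (cong (_∸ length ys) filter+ys≡xs)
    where
    ys≡∁ : length ys ≡ length (filter (∁? P?) xs)
    ys≡∁ = unique-⇔-length ys! (Unique.filter⁺ (∁? P?) xs!) (mk⇔
      (λ x∈ys → let (x∈xs , ¬Px) = to ys⇔ x∈ys in ∈-filter⁺ (∁? P?) x∈xs ¬Px)
      (λ x∈∁ → from ys⇔ (∈-filter⁻ (∁? P?) x∈∁)))
    filter+ys≡xs : length (filter P? xs) + length ys ≡ length xs
    filter+ys≡xs = trans (cong (length (filter P? xs) +_) ys≡∁) (length-filter+length-filter-∁ P? xs)

length-allFin : ∀ n → length (allFin n) ≡ n
length-allFin n = length-tabulate (λ i → i)

length-cartesianProductWith : {A B C : Set} (f : A → B → C) (xs : List A) (ys : List B) →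
  length (cartesianProductWith f xs ys) ≡ length xs * length ys
length-cartesianProductWith f []       ys = refl
length-cartesianProductWith f (x ∷ xs) ys = trans (length-++ (map (f x) ys))
  (cong₂ _+_ (length-map (f x) ys) (length-cartesianProductWith f xs ys))

words : {A : Set} → List A → ℕ → List (List A)
words xs zero    = [] ∷ []
words xs (suc k) = cartesianProductWith _∷_ xs (words xs k)

module _ {A : Set} {xs : List A} where

  words-unique : Unique xs → ∀ k → Unique (words xs k)
  words-unique xs! zero    = [] ∷ []
  words-unique xs! (suc k) = Unique.cartesianProductWith⁺ _∷_
    (λ eq → ∷-injectiveˡ eq , ∷-injectiveʳ eq) xs! (words-unique xs! k)

  length-words : ∀ k → length (words xs k) ≡ length xs ^ k
  length-words zero    = refl
  length-words (suc k) = trans (length-cartesianProductWith _∷_ xs (words xs k))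
                               (cong (length xs *_) (length-words k))

  ∈-words⇔ : ∀ k {w} → w ∈ words xs k ⇔ (length w ≡ k × All (_∈ xs) w)
  ∈-words⇔ _ = mk⇔ ∈-words⁻ ∈-words⁺
    where
    ∈-words⁻ : ∀ {k w} → w ∈ words xs k → length w ≡ k × All (_∈ xs) w
    ∈-words⁻ {zero}  (here refl) = refl , []
    ∈-words⁻ {suc k} w∈ with ∈-cartesianProductWith⁻ _∷_ xs (words xs k) w∈
    ... | x , w , x∈xs , w∈ , refl =
      let (len , w⊆xs) = ∈-words⁻ {k} w∈ in cong suc len , x∈xs ∷ w⊆xs
    ∈-words⁺ : ∀ {k w} → length w ≡ k × All (_∈ xs) w → w ∈ words xs k
    ∈-words⁺ {zero}  {[]}    (refl , [])         = here refl
    ∈-words⁺ {suc k} {x ∷ w} (len , x∈xs ∷ w⊆xs) =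
      ∈-cartesianProductWith⁺ _∷_ x∈xs (∈-words⁺ (suc-injective len , w⊆xs))

module _ {A B C : Set} (f : A → B → C) where

  dependentProductWith : List A → (A → List B) → List C
  dependentProductWith as S = concatMap (λ a → map (f a) (S a)) as

  ∈-dependentProductWith⇔ : ∀ as S {z} →
    z ∈ dependentProductWith as S ⇔ (∃₂ λ a x → a ∈ as × x ∈ S a × z ≡ f a x)
  ∈-dependentProductWith⇔ as S = mk⇔ ∈-dependentProductWith⁻ ∈-dependentProductWith⁺
    where
    ∈-dependentProductWith⁻ : ∀ {z} → z ∈ dependentProductWith as S →
                              ∃₂ λ a x → a ∈ as × x ∈ S a × z ≡ f a x
    ∈-dependentProductWith⁻ z∈ with find (∈-concatMap⁻ (λ a → map (f a) (S a)) {xs = as} z∈)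
    ... | a , a∈as , z∈fa with ∈-map⁻ (f a) z∈fa
    ...   | x , x∈Sa , z≡fax = a , x , a∈as , x∈Sa , z≡fax
    ∈-dependentProductWith⁺ : ∀ {z} → (∃₂ λ a x → a ∈ as × x ∈ S a × z ≡ f a x) →
                              z ∈ dependentProductWith as S
    ∈-dependentProductWith⁺ (a , x , a∈as , x∈Sa , refl) =
      ∈-concatMap⁺ _ (lose a∈as (∈-map⁺ (f a) x∈Sa))

  dependentProductWith-unique : (∀ {a a' x x'} → f a x ≡ f a' x' → a ≡ a' × x ≡ x') →
    ∀ {as S} → Unique as → (∀ a → Unique (S a)) → Unique (dependentProductWith as S)
  dependentProductWith-unique f-injective {as} {S} as! S! = Unique.concat⁺
    (All.map⁺ (All.universal (λ a → Unique.map⁺ (proj₂ ∘ f-injective) (S! a)) as))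
    (AllPairs.map⁺ (AllPairs.map disjoint as!))
    where
    disjoint : ∀ {a a'} → a ≢ a' → ∀ {z} → z ∈ map (f a) (S a) × z ∈ map (f a') (S a') → ⊥
    disjoint a≢a' (z∈ , z∈') with ∈-map⁻ _ z∈ | ∈-map⁻ _ z∈'
    ... | _ , _ , refl | _ , _ , eq = a≢a' (proj₁ (f-injective eq))

  length-dependentProductWith : ∀ {S k} as → (∀ {a} → a ∈ as → length (S a) ≡ k) →
    length (dependentProductWith as S) ≡ length as * k
  length-dependentProductWith         []       _      = refl
  length-dependentProductWith {S} (a ∷ as) |S|≡k = trans (length-++ (map (f a) (S a)))
    (cong₂ _+_ (trans (length-map (f a) (S a)) (|S|≡k (here refl)))
               (length-dependentProductWith as (|S|≡k ∘ there)))

escape-prefix-length : {A : Set} {L s s' t t' : List A} {y y' : A} →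
  All (_∈ L) s → All (_∈ L) s' → y ∉ L → y' ∉ L →
  s ++ y ∷ t ≡ s' ++ y' ∷ t' → length s ≡ length s'
escape-prefix-length []                    []        _   _    _  = refl
escape-prefix-length {L = L} []            (z∈L ∷ _) y∉L _    eq =
  contradiction (subst (_∈ L) (sym (∷-injectiveˡ eq)) z∈L) y∉L
escape-prefix-length {L = L} (z∈L ∷ _)     []        _   y'∉L eq =
  contradiction (subst (_∈ L) (∷-injectiveˡ eq) z∈L) y'∉L
escape-prefix-length (_ ∷ s⊆L) (_ ∷ s'⊆L) y∉L y'∉L eq =
  cong suc (escape-prefix-length s⊆L s'⊆L y∉L y'∉L (∷-injectiveʳ eq))

PrefixFree : ∀ {n m} → Vec (Word n) m → Set
PrefixFree {m = m} v = (i j : Fin m) → IsPrefix (lookup v i) (lookup v j) ⇔ i ≡ j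

module _ {n : ℕ} where

  open import Data.List.Membership.DecPropositional (_≟_ {n}) using (_∈?_)

  letters : Fin n × Fin n → List (Fin n)
  letters (a , b) = a ∷ b ∷ []

  Distinct : Fin n × Fin n → Set
  Distinct (a , b) = a ≢ b

  Escapes : Fin n × Fin n → Word n → Set
  Escapes p = First (_∈ letters p) (_∉ letters p)

  escapes-or-⊆ : ∀ p w → Escapes p w ⊎ All (_∈ letters p) w
  escapes-or-⊆ p = first (λ y → toSum (y ∈? letters p))

  triple : Fin n × Fin n → Word n → Vec (Word n) 3
  triple (a , b) w = (a ∷ []) ∷ (b ∷ []) ∷ w ∷ []

  triple-injective : ∀ {p p' w w'} → triple p w ≡ triple p' w' → p ≡ p' × w ≡ w'
  triple-injective refl = refl , refl

  triple-hasLengths : ∀ {c p w} → length w ≡ c → HasLengths (Lc c) (triple p w)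
  triple-hasLengths len zero             = refl
  triple-hasLengths len (suc zero)       = refl
  triple-hasLengths len (suc (suc zero)) = len

  hasLengths⇒triple : ∀ {c} v → HasLengths (Lc c) v → ∃₂ λ p w → v ≡ triple p w × length w ≡ c
  hasLengths⇒triple ((a ∷ []) ∷ (b ∷ []) ∷ w ∷ []) hl = (a , b) , w , refl , hl (suc (suc zero))
  hasLengths⇒triple ([] ∷ _)                       hl with () ← hl zero
  hasLengths⇒triple ((_ ∷ _ ∷ _) ∷ _)              hl with () ← hl zero
  hasLengths⇒triple ((_ ∷ []) ∷ [] ∷ _)            hl with () ← hl (suc zero)
  hasLengths⇒triple ((_ ∷ []) ∷ (_ ∷ _ ∷ _) ∷ _)   hl with () ← hl (suc zero)

  module Decipher {a b : Fin n} (a≢b : a ≢ b) {u r : Word n} {x : Fin n}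
                  (u⊆ab : All (_∈ letters (a , b)) u) (x∉ab : x ∉ letters (a , b)) where

    private
      ab : List (Fin n)
      ab = letters (a , b)
      w : Word n
      w = u ++ x ∷ r
      v : Vec (Word n) 3
      v = triple (a , b) w

    escape-not-before-u : ∀ is {s y t} → All (_∈ ab) s → y ∉ ab →
                          cat v is ≡ s ++ y ∷ t → length u ≤ length s
    escape-not-before-u []              {[]}    _          _    ()
    escape-not-before-u []              {_ ∷ _} _          _    ()
    escape-not-before-u (zero ∷ is)     {[]}    _          y∉ab eq =
      contradiction (here (sym (∷-injectiveˡ eq))) y∉ab
    escape-not-before-u (zero ∷ is)     {_ ∷ _} (_ ∷ s⊆ab) y∉ab eq =
      m≤n⇒m≤1+n (escape-not-before-u is s⊆ab y∉ab (∷-injectiveʳ eq))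
    escape-not-before-u (suc zero ∷ is) {[]}    _          y∉ab eq =
      contradiction (there (here (sym (∷-injectiveˡ eq)))) y∉ab
    escape-not-before-u (suc zero ∷ is) {_ ∷ _} (_ ∷ s⊆ab) y∉ab eq =
      m≤n⇒m≤1+n (escape-not-before-u is s⊆ab y∉ab (∷-injectiveʳ eq))
    escape-not-before-u (suc (suc zero) ∷ is) s⊆ab y∉ab eq = ≤-reflexive
      (escape-prefix-length u⊆ab s⊆ab x∉ab y∉ab (trans (sym (++-assoc u (x ∷ r) (cat v is))) eq))

    letter∷cat≢w++cat : ∀ {z} is js → z ∈ ab → z ∷ cat v is ≢ w ++ cat v js
    letter∷cat≢w++cat {z} is js z∈ab eq =
      <-irrefl refl (escape-after-letter u⊆ab (trans eq (++-assoc u (x ∷ r) (cat v js))))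
      where
      escape-after-letter : ∀ {s R} → All (_∈ ab) s → z ∷ cat v is ≡ s ++ x ∷ R →
                            length u < length s
      escape-after-letter []         eq' =
        contradiction (subst (_∈ ab) (∷-injectiveˡ eq') z∈ab) x∉ab
      escape-after-letter (_ ∷ s⊆ab) eq' = s≤s (escape-not-before-u is s⊆ab x∉ab (∷-injectiveʳ eq'))

    w++≢[] : ∀ rest → w ++ rest ≢ []
    w++≢[] rest eq with () ← ++-conicalʳ u (x ∷ r) (++-conicalˡ w rest eq)

    cat-injective : ∀ is js → cat v is ≡ cat v js → is ≡ js
    cat-injective []                    []                    _  = refl
    cat-injective []                    (zero ∷ _)            ()
    cat-injective []                    (suc zero ∷ _)        ()
    cat-injective []                    (suc (suc zero) ∷ js) eq = contradiction (sym eq) (w++≢[] _)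
    cat-injective (zero ∷ _)            []                    ()
    cat-injective (suc zero ∷ _)        []                    ()
    cat-injective (suc (suc zero) ∷ is) []                    eq = contradiction eq (w++≢[] _)
    cat-injective (zero ∷ is)           (zero ∷ js)           eq =
      cong (zero ∷_) (cat-injective is js (∷-injectiveʳ eq))
    cat-injective (zero ∷ is)           (suc zero ∷ js)       eq =
      contradiction (∷-injectiveˡ eq) a≢b
    cat-injective (zero ∷ is)           (suc (suc zero) ∷ js) eq =
      contradiction eq (letter∷cat≢w++cat is js (here refl))
    cat-injective (suc zero ∷ is)       (zero ∷ js)           eq =
      contradiction (sym (∷-injectiveˡ eq)) a≢b
    cat-injective (suc zero ∷ is)       (suc zero ∷ js)       eq =
      cong (suc zero ∷_) (cat-injective is js (∷-injectiveʳ eq))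
    cat-injective (suc zero ∷ is)       (suc (suc zero) ∷ js) eq =
      contradiction eq (letter∷cat≢w++cat is js (there (here refl)))
    cat-injective (suc (suc zero) ∷ is) (zero ∷ js)           eq =
      contradiction (sym eq) (letter∷cat≢w++cat js is (here refl))
    cat-injective (suc (suc zero) ∷ is) (suc zero ∷ js)       eq =
      contradiction (sym eq) (letter∷cat≢w++cat js is (there (here refl)))
    cat-injective (suc (suc zero) ∷ is) (suc (suc zero) ∷ js) eq =
      cong (suc (suc zero) ∷_) (cat-injective is js (++-cancelˡ w _ _ eq))

  escaping⇒isCode : ∀ {p w} → Distinct p → Escapes p w → IsCode (triple p w)
  escaping⇒isCode a≢b esc with toView esc
  ... | First._++_∷_ u⊆ab x∉ab r = λ is js _ _ → Decipher.cat-injective a≢b u⊆ab x∉ab is js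

  spell : ∀ {p w} → All (_∈ letters p) w → List (Fin 3)
  spell []                      = []
  spell (here _ ∷ w⊆ab)         = zero ∷ spell w⊆ab
  spell (there (here _) ∷ w⊆ab) = suc zero ∷ spell w⊆ab

  cat-spell : ∀ {p w' w} (w⊆ab : All (_∈ letters p) w) → cat (triple p w') (spell w⊆ab) ≡ w
  cat-spell []                         = refl
  cat-spell (here refl ∷ w⊆ab)         = cong (_ ∷_) (cat-spell w⊆ab)
  cat-spell (there (here refl) ∷ w⊆ab) = cong (_ ∷_) (cat-spell w⊆ab)

  triple-isCode⇔ : ∀ {p w} → IsCode (triple p w) ⇔ (Distinct p × Escapes p w)
  triple-isCode⇔ {a , b} {w} =
    mk⇔ (λ code → distinct code , escapes code) (λ (a≢b , esc) → escaping⇒isCode a≢b esc)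
    where
    distinct : IsCode (triple (a , b) w) → a ≢ b
    distinct code refl with () ← code (zero ∷ []) (suc zero ∷ []) (λ ()) (λ ()) refl
    spell-≢ : (w⊆ab : All (_∈ letters (a , b)) w) →
              suc (suc zero) ∷ suc (suc zero) ∷ [] ≢ suc (suc zero) ∷ spell w⊆ab
    spell-≢ []                   ()
    spell-≢ (here _ ∷ _)         ()
    spell-≢ (there (here _) ∷ _) ()
    -- a word w over {a, b} is deciphered both as w w and as w followed by its spelling in a, b
    escapes : IsCode (triple (a , b) w) → Escapes (a , b) w
    escapes code with escapes-or-⊆ (a , b) w
    ... | inj₁ esc  = esc
    ... | inj₂ w⊆ab = contradiction
      (code _ _ (λ ()) (λ ()) (cong (w ++_) (trans (++-identityʳ w) (sym (cat-spell w⊆ab)))))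
      (spell-≢ w⊆ab)

  triple-prefixFree⇔ : ∀ {p x t} → PrefixFree (triple p (x ∷ t)) ⇔ (Distinct p × x ∉ letters p)
  triple-prefixFree⇔ {a , b} {x} {t} = mk⇔ (λ pf → distinct pf , outside pf)
    (λ (a≢b , x∉ab) i j → mk⇔ (prefix⇒≡ a≢b x∉ab i j) λ { refl → [] , ++-identityʳ _ })
    where
    v : Vec (Word n) 3
    v = triple (a , b) (x ∷ t)
    distinct : PrefixFree v → a ≢ b
    distinct pf refl with () ← to (pf zero (suc zero)) ([] , refl)
    outside : PrefixFree v → x ∉ letters (a , b)
    outside pf (here refl)         with () ← to (pf zero (suc (suc zero))) (t , refl)
    outside pf (there (here refl)) with () ← to (pf (suc zero) (suc (suc zero))) (t , refl)
    prefix⇒≡ : a ≢ b → x ∉ letters (a , b) → ∀ i j → IsPrefix (lookup v i) (lookup v j) → i ≡ j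
    prefix⇒≡ _   _    zero             zero             _        = refl
    prefix⇒≡ _   _    (suc zero)       (suc zero)       _        = refl
    prefix⇒≡ _   _    (suc (suc zero)) (suc (suc zero)) _        = refl
    prefix⇒≡ a≢b _    zero             (suc zero)       (_ , eq) =
      contradiction (∷-injectiveˡ eq) a≢b
    prefix⇒≡ a≢b _    (suc zero)       zero             (_ , eq) =
      contradiction (sym (∷-injectiveˡ eq)) a≢b
    prefix⇒≡ _   x∉ab zero             (suc (suc zero)) (_ , eq) =
      contradiction (here (sym (∷-injectiveˡ eq))) x∉ab
    prefix⇒≡ _   x∉ab (suc zero)       (suc (suc zero)) (_ , eq) =
      contradiction (there (here (sym (∷-injectiveˡ eq)))) x∉ab
    prefix⇒≡ _   x∉ab (suc (suc zero)) zero             (_ , eq) =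
      contradiction (here (∷-injectiveˡ eq)) x∉ab
    prefix⇒≡ _   x∉ab (suc (suc zero)) (suc zero)       (_ , eq) =
      contradiction (there (here (∷-injectiveˡ eq))) x∉ab

  distinct? : Decidable Distinct
  distinct? (a , b) = ¬? (a ≟ b)

  allPairs : List (Fin n × Fin n)
  allPairs = cartesianProduct (allFin n) (allFin n)

  distinctPairs : List (Fin n × Fin n)
  distinctPairs = filter distinct? allPairs

  allWords : ℕ → List (Word n)
  allWords = words (allFin n)

  escapingWords : Fin n × Fin n → ℕ → List (Word n)
  escapingWords p c = filter (first? (_∈? letters p)) (allWords c)

  outsideLetters : Fin n × Fin n → List (Fin n)
  outsideLetters p = filter (∁? (_∈? letters p)) (allFin n)

  udCodes : ℕ → List (Vec (Word n) 3)
  udCodes c = dependentProductWith triple distinctPairs λ p → escapingWords p c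

  prCodes : ℕ → List (Vec (Word n) 3)
  prCodes c = dependentProductWith triple distinctPairs λ p →
                cartesianProductWith _∷_ (outsideLetters p) (allWords c)

  letters-unique : ∀ {p} → Distinct p → Unique (letters p)
  letters-unique a≢b = (a≢b ∷ []) ∷ [] ∷ []

  allPairs-unique : Unique allPairs
  allPairs-unique = Unique.cartesianProduct⁺ (Unique.allFin⁺ n) (Unique.allFin⁺ n)

  allWords-unique : ∀ c → Unique (allWords c)
  allWords-unique = words-unique (Unique.allFin⁺ n)

  length-allWords : ∀ c → length (allWords c) ≡ n ^ c
  length-allWords c = trans (length-words c) (cong (_^ c) (length-allFin n))

  ∈-allWords⇔ : ∀ c {w} → w ∈ allWords c ⇔ length w ≡ c
  ∈-allWords⇔ c {w} = mk⇔ (proj₁ ∘ to (∈-words⇔ c))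
                          (λ len → from (∈-words⇔ c) (len , All.universal ∈-allFin w))

  ∈-distinctPairs⇔ : ∀ {p} → p ∈ distinctPairs ⇔ Distinct p
  ∈-distinctPairs⇔ {a , b} = mk⇔ (proj₂ ∘ ∈-filter⁻ distinct? {xs = allPairs})
    (∈-filter⁺ distinct? (∈-cartesianProduct⁺ (∈-allFin a) (∈-allFin b)))

  ∈-escapingWords⇔ : ∀ {p c w} → w ∈ escapingWords p c ⇔ (length w ≡ c × Escapes p w)
  ∈-escapingWords⇔ {p} {c} = mk⇔
    (λ w∈ → let (w∈all , esc) = ∈-filter⁻ (first? (_∈? letters p)) {xs = allWords c} w∈
            in to (∈-allWords⇔ c) w∈all , esc)
    (λ (len , esc) → ∈-filter⁺ (first? (_∈? letters p)) (from (∈-allWords⇔ c) len) esc)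

  ∈-outsideLetters⇔ : ∀ {p x} → x ∈ outsideLetters p ⇔ x ∉ letters p
  ∈-outsideLetters⇔ {p} {x} = mk⇔ (proj₂ ∘ ∈-filter⁻ (∁? (_∈? letters p)) {xs = allFin n})
                                  (∈-filter⁺ (∁? (_∈? letters p)) (∈-allFin x))

  udCodes-enumerates : ∀ c → Enumerates (InUD n (Lc c)) (udCodes c)
  udCodes-enumerates c = enumerates
    (dependentProductWith-unique triple triple-injective (Unique.filter⁺ distinct? allPairs-unique)
      (λ p → Unique.filter⁺ _ (allWords-unique c)))
    (mk⇔ udCode⇒InUD InUD⇒udCode)
    where
    ∈-udCodes⇔ : ∀ {v} → v ∈ udCodes c ⇔
                 (∃₂ λ p w → p ∈ distinctPairs × w ∈ escapingWords p c × v ≡ triple p w)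
    ∈-udCodes⇔ = ∈-dependentProductWith⇔ triple distinctPairs (λ p → escapingWords p c)
    udCode⇒InUD : ∀ {v} → v ∈ udCodes c → InUD n (Lc c) v
    udCode⇒InUD v∈ with to ∈-udCodes⇔ v∈
    ... | p , w , p∈ , w∈ , refl = let (len , esc) = to ∈-escapingWords⇔ w∈ in
      triple-hasLengths len , from triple-isCode⇔ (to ∈-distinctPairs⇔ p∈ , esc)
    InUD⇒udCode : ∀ {v} → InUD n (Lc c) v → v ∈ udCodes c
    InUD⇒udCode {v} (hl , code) with hasLengths⇒triple v hl
    ... | p , w , refl , len = let (p-distinct , esc) = to triple-isCode⇔ code in
      from ∈-udCodes⇔
        (p , w , from ∈-distinctPairs⇔ p-distinct , from ∈-escapingWords⇔ (len , esc) , refl)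

  prCodes-enumerates : ∀ c → Enumerates (InPR n (Lc (suc c))) (prCodes c)
  prCodes-enumerates c = enumerates
    (dependentProductWith-unique triple triple-injective (Unique.filter⁺ distinct? allPairs-unique)
      (λ p → Unique.cartesianProductWith⁺ _∷_ (λ eq → ∷-injectiveˡ eq , ∷-injectiveʳ eq)
               (Unique.filter⁺ _ (Unique.allFin⁺ n)) (allWords-unique c)))
    (mk⇔ prCode⇒InPR InPR⇒prCode)
    where
    ∈-prCodes⇔ : ∀ {v} → v ∈ prCodes c ⇔
                 (∃₂ λ p w → p ∈ distinctPairs ×
                    w ∈ cartesianProductWith _∷_ (outsideLetters p) (allWords c) × v ≡ triple p w)
    ∈-prCodes⇔ = ∈-dependentProductWith⇔ triple distinctPairs
                   (λ p → cartesianProductWith _∷_ (outsideLetters p) (allWords c))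
    prCode⇒InPR : ∀ {v} → v ∈ prCodes c → InPR n (Lc (suc c)) v
    prCode⇒InPR v∈ with to ∈-prCodes⇔ v∈
    ... | p , _ , p∈ , w∈ , refl with ∈-cartesianProductWith⁻ _∷_ (outsideLetters p) (allWords c) w∈
    ...   | x , t , x∈ , t∈ , refl =
      let p-distinct = to ∈-distinctPairs⇔ p∈
          x∉ = to ∈-outsideLetters⇔ x∈
      in (triple-hasLengths (cong suc (to (∈-allWords⇔ c) t∈)) ,
          escaping⇒isCode p-distinct First.[ x∉ ]) ,
         from triple-prefixFree⇔ (p-distinct , x∉)
    InPR⇒prCode : ∀ {v} → InPR n (Lc (suc c)) v → v ∈ prCodes c
    InPR⇒prCode {v} ((hl , _) , pf) with hasLengths⇒triple v hl
    ... | p , x ∷ t , refl , len = let (p-distinct , x∉) = to triple-prefixFree⇔ pf in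
      from ∈-prCodes⇔ (p , x ∷ t , from ∈-distinctPairs⇔ p-distinct ,
        ∈-cartesianProductWith⁺ _∷_ (from ∈-outsideLetters⇔ x∉)
                                    (from (∈-allWords⇔ c) (suc-injective len)) ,
        refl)

  length-distinctPairs : length distinctPairs ≡ n * n ∸ n
  length-distinctPairs = trans
    (length-filter-by-complement distinct? allPairs-unique
      (Unique.map⁺ (cong proj₁) (Unique.allFin⁺ n)) diagonal⇔)
    (cong₂ _∸_ (trans (length-cartesianProductWith _,_ (allFin n) (allFin n))
                      (cong₂ _*_ (length-allFin n) (length-allFin n)))
               (trans (length-map _ (allFin n)) (length-allFin n)))
    where
    diagonal⇔ : ∀ {p} → p ∈ map (λ a → a , a) (allFin n) ⇔ (p ∈ allPairs × ¬ Distinct p)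
    diagonal⇔ {a , b} = mk⇔
      (λ p∈ → case ∈-map⁻ (λ a → a , a) p∈ of λ where
        (a , _ , refl) → ∈-cartesianProduct⁺ (∈-allFin a) (∈-allFin a) , λ a≢a → a≢a refl)
      (λ (_ , ¬a≢b) → case decidable-stable (a ≟ b) ¬a≢b of λ where
        refl → ∈-map⁺ (λ a → a , a) (∈-allFin a))

  length-distinctPairs>0 : 1 < n → 0 < length distinctPairs
  length-distinctPairs>0 1<n =
    subst (0 <_) (sym length-distinctPairs)
      (m<n⇒0<n∸m (m<m*n n n {{>-nonZero (<-trans z<s 1<n)}} 1<n))

  length-escapingWords : ∀ {p} → Distinct p → ∀ c → length (escapingWords p c) ≡ n ^ c ∸ 2 ^ c
  length-escapingWords {p} p-distinct c = trans
    (length-filter-by-complement (first? (_∈? letters p))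
      (allWords-unique c) (words-unique (letters-unique p-distinct) c) complement⇔)
    (cong₂ _∸_ (length-allWords c) (length-words c))
    where
    complement⇔ : ∀ {w} → w ∈ words (letters p) c ⇔ (w ∈ allWords c × ¬ Escapes p w)
    complement⇔ {w} = mk⇔
      (λ w∈ → let (len , w⊆ab) = to (∈-words⇔ c) w∈ in
        from (∈-allWords⇔ c) len , All⇒¬First (λ y∈ab y∉ab → y∉ab y∈ab) w⊆ab)
      (λ (w∈ , ¬esc) → case escapes-or-⊆ p w of λ where
        (inj₁ esc)  → contradiction esc ¬esc
        (inj₂ w⊆ab) → from (∈-words⇔ c) (to (∈-allWords⇔ c) w∈ , w⊆ab))

  length-outsideLetters : ∀ {p} → Distinct p → length (outsideLetters p) ≡ n ∸ 2
  length-outsideLetters {p} p-distinct = trans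
    (length-filter-by-complement (∁? (_∈? letters p)) (Unique.allFin⁺ n) (letters-unique p-distinct)
      (λ {x} → mk⇔ (λ x∈ab → ∈-allFin x , λ x∉ab → x∉ab x∈ab)
                   (λ (_ , ¬x∉ab) → decidable-stable (x ∈? letters p) ¬x∉ab)))
    (cong (_∸ 2) (length-allFin n))

  length-udCodes : ∀ c → length (udCodes c) ≡ length distinctPairs * (n ^ c ∸ 2 ^ c)
  length-udCodes c = length-dependentProductWith triple distinctPairs λ p∈ →
    length-escapingWords (to ∈-distinctPairs⇔ p∈) c

  length-prCodes : ∀ c → length (prCodes c) ≡ length distinctPairs * ((n ∸ 2) * n ^ c)
  length-prCodes c = length-dependentProductWith triple distinctPairs λ {p} p∈ →
    trans (length-cartesianProductWith _∷_ (outsideLetters p) (allWords c))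
          (cong₂ _*_ (length-outsideLetters (to ∈-distinctPairs⇔ p∈)) (length-allWords c))

bernoulli-3/2 : ∀ c → 2 ^ c * (2 + c) ≤ 2 * 3 ^ c
bernoulli-3/2 zero    = ≤-refl
bernoulli-3/2 (suc c) = begin
  2 ^ suc c * (3 + c)             ≤⟨ m≤m+n (2 ^ suc c * (3 + c)) (2 ^ c * c) ⟩
  2 ^ suc c * (3 + c) + 2 ^ c * c ≡⟨ regroup (2 ^ c) c ⟩
  3 * (2 ^ c * (2 + c))           ≤⟨ *-monoʳ-≤ 3 (bernoulli-3/2 c) ⟩
  3 * (2 * 3 ^ c)                 ≡⟨ swap (3 ^ c) ⟩
  2 * 3 ^ suc c                   ∎
  where
  open ≤-Reasoning
  regroup : ∀ T c → 2 * T * (3 + c) + T * c ≡ 3 * (T * (2 + c))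
  regroup = solve-∀
  swap : ∀ x → 3 * (2 * x) ≡ 2 * (3 * x)
  swap = solve-∀

2^c*[1+d]≤n^c : ∀ {n c d} → 3 ≤ n → 2 * d ≤ c → 2 ^ c * suc d ≤ n ^ c
2^c*[1+d]≤n^c {n} {c} {d} 3≤n 2d≤c = *-cancelˡ-≤ 2 (begin
  2 * (2 ^ c * suc d) ≡⟨ distribute (2 ^ c) d ⟩
  2 ^ c * (2 + 2 * d) ≤⟨ *-monoʳ-≤ (2 ^ c) (+-monoʳ-≤ 2 2d≤c) ⟩
  2 ^ c * (2 + c)     ≤⟨ bernoulli-3/2 c ⟩
  2 * 3 ^ c           ≤⟨ *-monoʳ-≤ 2 (^-monoˡ-≤ c 3≤n) ⟩
  2 * n ^ c           ∎)
  where
  open ≤-Reasoning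
  distribute : ∀ T d → 2 * (T * suc d) ≡ T * (2 + 2 * d)
  distribute = solve-∀

frac-distance< : ∀ {P U A n K e d} .{cop : Coprime (suc e) (suc d)} → 0 < U → 0 < n →
  P * n ≡ A * U + K → K * suc d < suc e * (U * n) →
  ∣ frac P U - frac A n ∣ <ℚ mkℚ (ℤ.+ suc e) d cop
frac-distance< {P} {suc q} {A} {suc m} {K} {e} {d} _ _ Pn≡AU+K K[1+d]<[1+e]Un =
  ℚ.toℚᵘ-cancel-< (ℚᵘ.<-respˡ-≃ (ℚᵘ.≃-sym toℚᵘ-distance) (ℚᵘ.*<* numerator<))
  where
  X Y : ℚᵘ.ℚᵘ
  X = ℚᵘ.mkℚᵘ (ℤ.+ P) q
  Y = ℚᵘ.mkℚᵘ (ℤ.+ A) m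
  toℚᵘ-distance : toℚᵘ ∣ frac P (suc q) - frac A (suc m) ∣ ℚᵘ.≃ ℚᵘ.∣ X ℚᵘ.- Y ∣
  toℚᵘ-distance =
    ℚᵘ.≃-trans (ℚ.toℚᵘ-homo-∣-∣ (frac P (suc q) - frac A (suc m))) (ℚᵘ.∣-∣-cong
      (ℚᵘ.≃-trans (ℚ.toℚᵘ-homo-+ (frac P (suc q)) (ℚ.- frac A (suc m))) (ℚᵘ.+-cong (ℚ.toℚᵘ-fromℚᵘ X)
        (ℚᵘ.≃-trans (ℚ.toℚᵘ-homo‿- (frac A (suc m))) (ℚᵘ.-‿cong (ℚ.toℚᵘ-fromℚᵘ Y))))))
  ⟦P⟧ ⟦A⟧ ⟦U⟧ ⟦n⟧ : ℤ.ℤ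
  ⟦P⟧ = ℤ.+ P
  ⟦A⟧ = ℤ.+ A
  ⟦U⟧ = ℤ.+ suc q
  ⟦n⟧ = ℤ.+ suc m
  numerator≡K : ⟦P⟧ ℤ.* ⟦n⟧ ℤ.+ ℤ.- ⟦A⟧ ℤ.* ⟦U⟧ ≡ ℤ.+ K
  numerator≡K = begin
    ⟦P⟧ ℤ.* ⟦n⟧ ℤ.+ ℤ.- ⟦A⟧ ℤ.* ⟦U⟧           ≡⟨ cong (ℤ._+ ℤ.- ⟦A⟧ ℤ.* ⟦U⟧) (ℤ.pos-* P (suc m)) ⟨
    ℤ.+ (P * suc m) ℤ.+ ℤ.- ⟦A⟧ ℤ.* ⟦U⟧       ≡⟨ cong (λ z → ℤ.+ z ℤ.+ ℤ.- ⟦A⟧ ℤ.* ⟦U⟧) Pn≡AU+K ⟩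
    ℤ.+ (A * suc q + K) ℤ.+ ℤ.- ⟦A⟧ ℤ.* ⟦U⟧   ≡⟨ cong (ℤ._+ ℤ.- ⟦A⟧ ℤ.* ⟦U⟧) ⟦AU+K⟧ ⟩
    ⟦A⟧ ℤ.* ⟦U⟧ ℤ.+ ℤ.+ K ℤ.+ ℤ.- ⟦A⟧ ℤ.* ⟦U⟧ ≡⟨ cancel ⟦A⟧ ⟦U⟧ (ℤ.+ K) ⟩
    ℤ.+ K                                      ∎
    where
    open ≡-Reasoning
    ⟦AU+K⟧ : ℤ.+ (A * suc q + K) ≡ ⟦A⟧ ℤ.* ⟦U⟧ ℤ.+ ℤ.+ K
    ⟦AU+K⟧ = trans (ℤ.pos-+ (A * suc q) K) (cong (ℤ._+ ℤ.+ K) (ℤ.pos-* A (suc q)))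
    cancel : ∀ x y k → x ℤ.* y ℤ.+ k ℤ.+ ℤ.- x ℤ.* y ≡ k
    cancel = ℤ-Solver.solve-∀
  numerator< : ℤ.+ ℤ.∣ ⟦P⟧ ℤ.* ⟦n⟧ ℤ.+ ℤ.- ⟦A⟧ ℤ.* ⟦U⟧ ∣ ℤ.* ℤ.+ suc d
               ℤ.< ℤ.+ suc e ℤ.* ℤ.+ (suc q * suc m)
  numerator< rewrite numerator≡K =
    subst₂ ℤ._<_ (ℤ.pos-* K (suc d)) (ℤ.pos-* (suc e) (suc q * suc m)) (ℤ.+<+ K[1+d]<[1+e]Un)

prefix-count-identity : ∀ D k n c S T → S + T ≡ n * n ^ c →
  D * (k * n ^ c) * n ≡ k * (D * S) + D * (k * T)
prefix-count-identity D k n c S T S+T≡n^[1+c] = begin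
  D * (k * n ^ c) * n       ≡⟨ regroup D k (n ^ c) n ⟩
  D * k * (n * n ^ c)       ≡⟨ cong (D * k *_) S+T≡n^[1+c] ⟨
  D * k * (S + T)           ≡⟨ distribute D k S T ⟩
  k * (D * S) + D * (k * T) ∎
  where
  open ≡-Reasoning
  regroup : ∀ D k x n → D * (k * x) * n ≡ D * k * (n * x)
  regroup = solve-∀
  distribute : ∀ D k S T → D * k * (S + T) ≡ k * (D * S) + D * (k * T)
  distribute = solve-∀

error-term< : ∀ {D k n S T d} e → 0 < D → 0 < T → k < n → T * suc d ≤ S →
  D * (k * T) * suc d < suc e * (D * S * n)
error-term< {D} {k} {n} {S} {T} {d} e D>0 T>0 k<n T[1+d]≤S = begin-strict
  D * (k * T) * suc d   ≡⟨ regroup D k T (suc d) ⟩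
  k * (D * (T * suc d)) ≤⟨ *-monoʳ-≤ k (*-monoʳ-≤ D T[1+d]≤S) ⟩
  k * (D * S)           <⟨ *-monoˡ-< (D * S) {{>-nonZero DS>0}} k<n ⟩
  n * (D * S)           ≤⟨ m≤n*m (n * (D * S)) (suc e) ⟩
  suc e * (n * (D * S)) ≡⟨ cong (suc e *_) (*-comm n (D * S)) ⟩
  suc e * (D * S * n)   ∎
  where
  open ≤-Reasoning
  regroup : ∀ D k T d → D * (k * T) * d ≡ k * (D * (T * d))
  regroup = solve-∀
  DS>0 : 0 < D * S
  DS>0 = *-mono-≤ D>0 (≤-trans (*-mono-≤ T>0 (s≤s z≤n)) T[1+d]≤S)

prefix-ratio-close : ∀ {n c D e d} .{cop : Coprime (suc e) (suc d)} → 2 < n → 0 < D →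
  2 * suc d ≤ suc c →
  ∣ frac (D * ((n ∸ 2) * n ^ c)) (D * (n ^ suc c ∸ 2 ^ suc c)) - frac (n ∸ 2) n ∣
    <ℚ mkℚ (ℤ.+ suc e) d cop
prefix-ratio-close {suc zero} (s≤s ())
prefix-ratio-close {n@(suc (suc k))} {c} {D} {e} {d} 2<n D>0 2[1+d]≤1+c =
  frac-distance< {A = k} {K = D * (k * T)} (*-mono-≤ D>0 S>0) z<s
    (prefix-count-identity D k n c S T S+T≡n^[1+c])
    (error-term< e D>0 (m^n>0 2 (suc c)) (m<n+m k z<s) T[1+d]≤S)
  where
  T S : ℕ
  T = 2 ^ suc c
  S = n ^ suc c ∸ T
  S+T≡n^[1+c] : S + T ≡ n ^ suc c
  S+T≡n^[1+c] = m∸n+n≡m (^-monoˡ-≤ (suc c) (s≤s (s≤s z≤n)))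
  T[1+d]≤S : T * suc d ≤ S
  T[1+d]≤S = +-cancelˡ-≤ T (T * suc d) S (begin
    T + T * suc d   ≡⟨ *-suc T (suc d) ⟨
    T * suc (suc d) ≤⟨ 2^c*[1+d]≤n^c 2<n 2[1+d]≤1+c ⟩
    n ^ suc c       ≡⟨ trans (sym S+T≡n^[1+c]) (+-comm S T) ⟩
    T + S           ∎)
    where open ≤-Reasoning
  S>0 : 0 < S
  S>0 = ≤-trans (*-mono-≤ (m^n>0 2 (suc c)) z<s) T[1+d]≤S

theorem5 : (n : ℕ) → 2 < n → (ε : ℚ) → 0ℚ <ℚ ε →
    ∃[ N ] ((c : ℕ) → N ≤ c → 1 ≤ c →
      (us ps : List (Vec (Word n) 3)) →
      Enumerates (InUD n (Lc c)) us → Enumerates (InPR n (Lc c)) ps →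
      ∣ frac (length ps) (length us) - frac (n ∸ 2) n ∣ <ℚ ε)
theorem5 n _   (mkℚ (ℤ.+ zero) _ _)   (*<* (ℤ.+<+ ()))
theorem5 n _   (mkℚ ℤ.-[1+ _ ] _ _)   (*<* ())
theorem5 n 2<n (mkℚ (ℤ.+ suc e) d _) _ = 2 * suc d , ρ-close
  where
  ρ-close : (c : ℕ) → 2 * suc d ≤ c → 1 ≤ c → (us ps : List (Vec (Word n) 3)) →
    Enumerates (InUD n (Lc c)) us → Enumerates (InPR n (Lc c)) ps →
    ∣ frac (length ps) (length us) - frac (n ∸ 2) n ∣ <ℚ mkℚ (ℤ.+ suc e) d _
  ρ-close (suc c) 2[1+d]≤1+c _ us ps us-enum ps-enum
    rewrite enumerates-length us-enum (udCodes-enumerates (suc c))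
          | enumerates-length ps-enum (prCodes-enumerates c)
          | length-udCodes {n} (suc c)
          | length-prCodes {n} c
    = prefix-ratio-close 2<n (length-distinctPairs>0 (<⇒≤ 2<n)) 2[1+d]≤1+c
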